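{- For every positive integer $k$, the graph $G=kC_7$ (the disjoint union of $k$ cycles on $7$ vertices), which has $n=7k$ vertices, has exactly $14^k=14^{n/7}\ge 1.4579^n$ maximal matching cuts.
   Context: A matching cut of a graph $G$ is a (possibly empty) edge set $M$ that is a matching and equals $E(A,B)$, the set of edges between $A$ and $B$, for some partition $\{A,B\}$ of $V(G)$. A matching cut $M$ is maximal if no matching cut of $G$ strictly contains $M$. -}

module Defs where

open import Data.Nat using (ℕ; suc; _*_; _/_; _%_)
open import Data.Fin using (Fin; toℕ)
open import Data.Fin.Subset using (Subset; _∈_; _∉_; Nonempty)
open import Data.Bool using (Bool; true)
open import Data.Vec using (Vec; lookup)
open import Data.Product using (_×_; ∃-syntax; Σ-syntax)
open import Data.Sum using (_⊎_)
open import Relation.Nullary using (¬_)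
open import Relation.Binary.PropositionalEquality using (_≡_)

record Graph : Set₁ where
  field
    n   : ℕ
    Adj : Fin n → Fin n → Set
open Graph public

-- An edge set of a graph on Fin n, represented canonically as a 0/1 matrix:
-- the unordered edge uv belongs to M iff entry (u,v) is true.
EdgeSet : ℕ → Set
EdgeSet n = Vec (Vec Bool n) n

_∋ₑ_,_ : ∀ {n} → EdgeSet n → Fin n → Fin n → Set
M ∋ₑ u , v = lookup (lookup M u) v ≡ true

_⊆ₑ_ : ∀ {n} → EdgeSet n → EdgeSet n → Set
M ⊆ₑ M' = ∀ u v → M ∋ₑ u , v → M' ∋ₑ u , v

IsCutOf : (G : Graph) → Subset (n G) → EdgeSet (n G) → Set
IsCutOf G A M = ∀ u v → (M ∋ₑ u , v → Adj G u v × ((u ∈ A × v ∉ A) ⊎ (u ∉ A × v ∈ A)))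
                      × (Adj G u v × ((u ∈ A × v ∉ A) ⊎ (u ∉ A × v ∈ A)) → M ∋ₑ u , v)

IsMatching : ∀ {n} → EdgeSet n → Set
IsMatching M = ∀ u v w → M ∋ₑ u , v → M ∋ₑ u , w → v ≡ w

IsMatchingCut : (G : Graph) → EdgeSet (n G) → Set
IsMatchingCut G M =
  IsMatching M × ∃[ A ] (Nonempty A × Nonempty (Data.Fin.Subset.∁ A) × IsCutOf G A M)

IsMaximalMatchingCut : (G : Graph) → EdgeSet (n G) → Set
IsMaximalMatchingCut G M =
  IsMatchingCut G M × (∀ M' → IsMatchingCut G M' → M ⊆ₑ M' → M' ≡ M)

-- k C_7: vertex i ∈ Fin (7k) is the vertex (i % 7) of the (i / 7)-th cycle;
-- the j-th vertex of a cycle is adjacent to vertices j ± 1 (mod 7).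
kC7 : ℕ → Graph
kC7 k = record
  { n   = 7 * k
  ; Adj = λ u v → (toℕ u / 7 ≡ toℕ v / 7)
                × ((toℕ u % 7 ≡ suc (toℕ v % 7) % 7) ⊎ (toℕ v % 7 ≡ suc (toℕ u % 7) % 7))
  }

module Submission where

-- A side A of a cut of k C₇ meets each cycle in a vertex set whose boundary (the cut edges on
-- that cycle) has even size, and the cut is a matching iff no two boundary edges are consecutive.
-- On C₇ this leaves the empty boundary and the 14 pairs of non-adjacent edges, found by exhausting
-- the 2⁷ vertex sets of C₇. No such boundary strictly contains a pair, and an empty cycle can be
-- given a pair to enlarge the cut, so the maximal matching cuts are exactly the choices of one pair
-- on every cycle. The bound is 14579⁷ ≤ 14 · 10000⁷, i.e. 14^(1/7) ≥ 1.4579.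

open import Defs
open import Data.Nat using (ℕ; _*_; _^_; _≤_; NonZero)
open import Data.List using (List; length)
open import Data.List.Membership.Propositional using (_∈_)
open import Data.List.Relation.Unary.Unique.Propositional using (Unique)
open import Data.Product using (_×_; ∃-syntax)
open import Function.Bundles using (_⇔_)
open import Relation.Binary.PropositionalEquality using (_≡_)

open import Data.Bool using (Bool; true; false; not; _∧_; _xor_)
open import Data.Bool.Properties using (⇔→≡) renaming (_≟_ to _≟ᵇ_)
open import Data.Empty using (⊥-elim)
open import Data.Fin using (Fin; zero; suc; toℕ; fromℕ<) renaming (_≟_ to _≟ᶠ_)
open import Data.Fin.Properties using (all?; any?; toℕ-injective; toℕ-fromℕ<; toℕ<n)
open import Data.Fin.Subset using (Subset; _⊆_; ⊥; Nonempty; ∁)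
  renaming (_∈_ to _∈ₛ_; _∉_ to _∉ₛ_)
open import Data.Fin.Subset.Properties
  using (_∈?_; _⊆?_; anySubset?; nonempty?; ⊆-reflexive; ⊆-antisym; ⊆-min; ∉⊥)
open import Data.List as List using ([]; _∷_; map; cartesianProductWith; allFin)
import Data.List.Properties as List
import Data.List.Relation.Unary.All as All
import Data.List.Relation.Unary.AllPairs as AllPairs
open import Data.List.Relation.Unary.Any using (here)
import Data.List.Relation.Unary.Any.Properties as Any
import Data.List.Relation.Unary.Unique.Propositional.Properties as Unique
open import Data.List.Membership.Propositional.Properties using (∈-allFin; ∈-map⁺; ∈-map⁻)
open import Data.Nat as ℕ using (zero; suc; _+_; _<_; _%_; _/_; _<ᵇ_; _≤ᵇ_)
import Data.Nat.Properties as ℕ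
open import Data.Nat.DivMod
  using (_mod_; m≡m%n+[m/n]*n; [m+kn]%n≡m%n; m<n⇒m%n≡m; m<n⇒m/n≡0; m*n/n≡m; +-distrib-/-∣ʳ; m<n*o⇒m/o<n)
open import Data.Nat.Divisibility using (n∣m*n)
open import Data.Product using (_,_; proj₁; proj₂)
open import Data.Sum using (_⊎_; inj₁; inj₂; [_,_]; swap)
open import Data.Unit using (tt)
open import Algebra.Properties.CommutativeSemigroup ℕ.*-commutativeSemigroup using (interchange)
open import Data.Vec as Vec using (Vec; []; _∷_; lookup; tabulate)
import Data.Vec.Properties as Vec
open import Data.Vec.Relation.Binary.Pointwise.Extensional using (ext; Pointwise-≡⇒≡)
open import Data.Vec.Functional using (updateAt)
open import Data.Vec.Functional.Properties using (updateAt-updates; updateAt-minimal)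
open import Function using (_∘_; const)
open import Function.Bundles using (mk⇔; Equivalence)
open import Function.Properties.Equivalence using () renaming (trans to ⇔-trans; sym to ⇔-sym)
open import Data.Sum.Function.Propositional using (_⊎-⇔_)
open import Data.Product.Function.NonDependent.Propositional using (_×-⇔_)
open import Relation.Nullary using (Dec; yes; no; does; ¬_; ¬?)
open import Relation.Nullary.Decidable
  using (from-yes; _×-dec_; _⊎-dec_; _→-dec_; map′; decidable-stable)
open import Relation.Unary using (Pred; Decidable)
open import Relation.Binary.PropositionalEquality
  using (_≢_; refl; sym; trans; cong; cong₂; subst; subst₂; module ≡-Reasoning)

open Equivalence using (to; from)

private
  variable
    m : ℕ

does-true⇔ : ∀ {p} {P : Set p} (P? : Dec P) → does P? ≡ true ⇔ P
does-true⇔ (yes p) = mk⇔ (const p) (const refl)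
does-true⇔ (no ¬p) = mk⇔ (λ ()) (λ p → ⊥-elim (¬p p))

∈ₛ⇔lookup : ∀ {x : Fin m} {s : Subset m} → x ∈ₛ s ⇔ lookup s x ≡ true
∈ₛ⇔lookup {x = x} {s} = mk⇔ Vec.[]=⇒lookup (Vec.lookup⇒[]= x s)

∉ₛ⇔lookup : ∀ {x : Fin m} {s : Subset m} → x ∉ₛ s ⇔ lookup s x ≡ false
∉ₛ⇔lookup {x = x} {s} with lookup s x in sx
... | true  = mk⇔ (λ x∉ → ⊥-elim (x∉ (Vec.lookup⇒[]= x s sx))) λ ()
... | false = mk⇔ (const refl) (λ _ x∈ → true≢false (trans (sym (Vec.[]=⇒lookup x∈)) sx))
  where
  true≢false : true ≢ false
  true≢false ()

allSubsets? : ∀ {p} {P : Pred (Subset m) p} → Decidable P → Dec (∀ s → P s)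
allSubsets? P? = map′ (λ ¬∃¬ s → decidable-stable (P? s) (λ ¬Ps → ¬∃¬ (s , ¬Ps)))
                      (λ ∀P (s , ¬Ps) → ¬Ps (∀P s))
                      (¬? (anySubset? (¬? ∘ P?)))

≡ₑ-intro : {M M′ : EdgeSet m} → (∀ u v → M ∋ₑ u , v ⇔ M′ ∋ₑ u , v) → M ≡ M′
≡ₑ-intro M⇔M′ = Pointwise-≡⇒≡ (ext λ u → Pointwise-≡⇒≡ (ext λ v → ⇔→≡ (M⇔M′ u v)))

⊆ₑ-antisym : {M M′ : EdgeSet m} → M ⊆ₑ M′ → M′ ⊆ₑ M → M ≡ M′
⊆ₑ-antisym M⊆M′ M′⊆M = ≡ₑ-intro λ u v → mk⇔ (M⊆M′ u v) (M′⊆M u v)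

⊆ₑ-reflexive : {M M′ : EdgeSet m} → M ≡ M′ → M ⊆ₑ M′
⊆ₑ-reflexive refl u v uv = uv

Separates : Subset m → Fin m → Fin m → Set
Separates A u v = (u ∈ₛ A × v ∉ₛ A) ⊎ (u ∉ₛ A × v ∈ₛ A)

separates? : ∀ (A : Subset m) u v → Dec (Separates A u v)
separates? A u v = (u ∈? A ×-dec ¬? (v ∈? A)) ⊎-dec (¬? (u ∈? A) ×-dec v ∈? A)

separates-sym : ∀ {A : Subset m} {u v} → Separates A u v → Separates A v u
separates-sym = [ (λ (u∈ , v∉) → inj₂ (v∉ , u∈)) , (λ (u∉ , v∈) → inj₁ (v∈ , u∉)) ]

xor≡true⇔ : ∀ a b → (a xor b) ≡ true ⇔ ((a ≡ true × b ≡ false) ⊎ (a ≡ false × b ≡ true))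
xor≡true⇔ true  true  = mk⇔ (λ ()) [ (λ ()) ∘ proj₂ , (λ ()) ∘ proj₁ ]
xor≡true⇔ true  false = mk⇔ (const (inj₁ (refl , refl))) (const refl)
xor≡true⇔ false true  = mk⇔ (const (inj₂ (refl , refl))) (const refl)
xor≡true⇔ false false = mk⇔ (λ ()) [ (λ ()) ∘ proj₁ , (λ ()) ∘ proj₂ ]

separates⇔xor : ∀ (A : Subset m) u v → Separates A u v ⇔ (lookup A u xor lookup A v) ≡ true
separates⇔xor A u v = ⇔-trans ((∈ₛ⇔lookup ×-⇔ ∉ₛ⇔lookup) ⊎-⇔ (∉ₛ⇔lookup ×-⇔ ∈ₛ⇔lookup))
                              (⇔-sym (xor≡true⇔ (lookup A u) (lookup A v)))

module CutSets (G : Graph) (adj? : ∀ u v → Dec (Adj G u v)) where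

  opaque
    cutSet : Subset (n G) → EdgeSet (n G)
    cutSet A = tabulate λ u → tabulate λ v → does (adj? u v ×-dec separates? A u v)

    cutSet-∋⇔ : ∀ {A u v} → cutSet A ∋ₑ u , v ⇔ (Adj G u v × Separates A u v)
    cutSet-∋⇔ {A} {u} {v}
      rewrite Vec.lookup∘tabulate (λ u → tabulate λ v → does (adj? u v ×-dec separates? A u v)) u
            | Vec.lookup∘tabulate (λ v → does (adj? u v ×-dec separates? A u v)) v
      = does-true⇔ (adj? u v ×-dec separates? A u v)

  cutSet-isCut : ∀ A → IsCutOf G A (cutSet A)
  cutSet-isCut A u v = to cutSet-∋⇔ , from cutSet-∋⇔

  isCut⇒≡cutSet : ∀ {A M} → IsCutOf G A M → M ≡ cutSet A
  isCut⇒≡cutSet cut = ≡ₑ-intro λ u v →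
    mk⇔ (from cutSet-∋⇔ ∘ proj₁ (cut u v)) (proj₂ (cut u v) ∘ to cutSet-∋⇔)

  cutSet-sym : (∀ u v → Adj G u v → Adj G v u) →
               ∀ {A u v} → cutSet A ∋ₑ u , v → cutSet A ∋ₑ v , u
  cutSet-sym adj-sym {u = u} {v} uv =
    let (a , s) = to cutSet-∋⇔ uv in from cutSet-∋⇔ (adj-sym u v a , separates-sym s)

-- The cycle C₇

next : Fin 7 → Fin 7
next j = suc (toℕ j) mod 7

toℕ-next : ∀ j → toℕ (next j) ≡ suc (toℕ j) % 7
toℕ-next j = toℕ-fromℕ< _

-- The cycle edge j of C₇ joins the vertices j and next j.
boundary : Subset 7 → Subset 7
boundary s = tabulate λ j → lookup s j xor lookup s (next j)

IsCycleMatching : Subset 7 → Set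
IsCycleMatching e = ∀ j → j ∈ₛ e → next j ∉ₛ e

isCycleMatching? : Decidable IsCycleMatching
isCycleMatching? e = all? λ j → j ∈? e →-dec ¬? (next j ∈? e)

-- arc t is the path a+1, …, b with (a , b) the t-th entry of arcEnds; its boundary
-- is the pair of edges {a , b}, and these are the 14 pairs of non-adjacent edges of C₇.
arcEnds : Vec (ℕ × ℕ) 14
arcEnds = (0 , 2) ∷ (0 , 3) ∷ (0 , 4) ∷ (0 , 5) ∷ (1 , 3) ∷ (1 , 4) ∷ (1 , 5) ∷ (1 , 6)
        ∷ (2 , 4) ∷ (2 , 5) ∷ (2 , 6) ∷ (3 , 5) ∷ (3 , 6) ∷ (4 , 6) ∷ []

arc : Fin 14 → Subset 7
arc t = tabulate λ j → (proj₁ (lookup arcEnds t) <ᵇ toℕ j) ∧ (toℕ j ≤ᵇ proj₂ (lookup arcEnds t))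

_≟ₛ_ : (s s′ : Subset m) → Dec (s ≡ s′)
_≟ₛ_ = Vec.≡-dec _≟ᵇ_

-- Opaque, so that applying these facts never unfolds the exhaustive decision procedures.
opaque
  next-injective : ∀ i j → next i ≡ next j → i ≡ j
  next-injective = from-yes (all? λ i → all? λ j → next i ≟ᶠ next j →-dec i ≟ᶠ j)

  next²≢id : ∀ j → j ≢ next (next j)
  next²≢id = from-yes (all? λ j → ¬? (j ≟ᶠ next (next j)))

  zero∈boundary-arc-zero : zero ∈ₛ boundary (arc zero)
  zero∈boundary-arc-zero = Vec.here

  arc-nonempty : ∀ t → Nonempty (arc t)
  arc-nonempty = from-yes (all? λ t → nonempty? (arc t))

  arc-∁-nonempty : ∀ t → Nonempty (∁ (arc t))
  arc-∁-nonempty = from-yes (all? λ t → nonempty? (∁ (arc t)))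

  boundary-arc-isCycleMatching : ∀ t → IsCycleMatching (boundary (arc t))
  boundary-arc-isCycleMatching = from-yes (all? λ t → isCycleMatching? (boundary (arc t)))

  boundary-arc-injective : ∀ t t′ → boundary (arc t) ≡ boundary (arc t′) → t ≡ t′
  boundary-arc-injective =
    from-yes (all? λ t → all? λ t′ → boundary (arc t) ≟ₛ boundary (arc t′) →-dec t ≟ᶠ t′)

  boundary-arc-maximal : ∀ s t → IsCycleMatching (boundary s) →
                         boundary (arc t) ⊆ boundary s → boundary s ≡ boundary (arc t)
  boundary-arc-maximal = from-yes (allSubsets? λ s → all? λ t →
    isCycleMatching? (boundary s) →-dec
      (boundary (arc t) ⊆? boundary s →-dec boundary s ≟ₛ boundary (arc t)))

  isCycleMatching-boundary⇒arc⊎⊥ : ∀ s → IsCycleMatching (boundary s) →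
                                   (∃[ t ] boundary s ≡ boundary (arc t)) ⊎ boundary s ≡ ⊥
  isCycleMatching-boundary⇒arc⊎⊥ = from-yes (allSubsets? λ s →
    isCycleMatching? (boundary s) →-dec
      (any? (λ t → boundary s ≟ₛ boundary (arc t)) ⊎-dec boundary s ≟ₛ ⊥))

module Cycles (k : ℕ) where

  V : Set
  V = Fin (7 * k)

  -- Opaque, so that cycleOf u, positionOf u and vertex i j unify as neutral terms.
  opaque
    cycleOf : V → Fin k
    cycleOf u = fromℕ< (m<n*o⇒m/o<n (subst (toℕ u <_) (ℕ.*-comm 7 k) (toℕ<n u)))

    positionOf : V → Fin 7
    positionOf u = toℕ u mod 7

    vertex : Fin k → Fin 7 → V
    vertex i j = fromℕ< (begin-strict
        toℕ j + toℕ i * 7   <⟨ ℕ.+-monoˡ-< (toℕ i * 7) (toℕ<n j) ⟩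
        suc (toℕ i) * 7     ≤⟨ ℕ.*-monoˡ-≤ 7 (toℕ<n i) ⟩
        k * 7               ≡⟨ ℕ.*-comm k 7 ⟩
        7 * k               ∎)
      where open ℕ.≤-Reasoning

    toℕ-cycleOf : ∀ u → toℕ (cycleOf u) ≡ toℕ u / 7
    toℕ-cycleOf u = toℕ-fromℕ< _

    toℕ-positionOf : ∀ u → toℕ (positionOf u) ≡ toℕ u % 7
    toℕ-positionOf u = toℕ-fromℕ< _

    toℕ-vertex : ∀ i j → toℕ (vertex i j) ≡ toℕ j + toℕ i * 7
    toℕ-vertex i j = toℕ-fromℕ< _

  cycleOf-vertex : ∀ i j → cycleOf (vertex i j) ≡ i
  cycleOf-vertex i j = toℕ-injective (begin
      toℕ (cycleOf (vertex i j))   ≡⟨ toℕ-cycleOf (vertex i j) ⟩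
      toℕ (vertex i j) / 7         ≡⟨ cong (_/ 7) (toℕ-vertex i j) ⟩
      (toℕ j + toℕ i * 7) / 7      ≡⟨ +-distrib-/-∣ʳ (toℕ j) (n∣m*n (toℕ i)) ⟩
      toℕ j / 7 + toℕ i * 7 / 7    ≡⟨ cong₂ _+_ (m<n⇒m/n≡0 (toℕ<n j)) (m*n/n≡m (toℕ i) 7) ⟩
      toℕ i                        ∎)
    where open ≡-Reasoning

  positionOf-vertex : ∀ i j → positionOf (vertex i j) ≡ j
  positionOf-vertex i j = toℕ-injective (begin
      toℕ (positionOf (vertex i j))   ≡⟨ toℕ-positionOf (vertex i j) ⟩
      toℕ (vertex i j) % 7            ≡⟨ cong (_% 7) (toℕ-vertex i j) ⟩
      (toℕ j + toℕ i * 7) % 7         ≡⟨ [m+kn]%n≡m%n (toℕ j) (toℕ i) 7 ⟩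
      toℕ j % 7                       ≡⟨ m<n⇒m%n≡m (toℕ<n j) ⟩
      toℕ j                           ∎)
    where open ≡-Reasoning

  vertex-cycleOf-positionOf : ∀ u → vertex (cycleOf u) (positionOf u) ≡ u
  vertex-cycleOf-positionOf u = toℕ-injective (begin
      toℕ (vertex (cycleOf u) (positionOf u))     ≡⟨ toℕ-vertex (cycleOf u) (positionOf u) ⟩
      toℕ (positionOf u) + toℕ (cycleOf u) * 7    ≡⟨ cong₂ (λ p c → p + c * 7) (toℕ-positionOf u) (toℕ-cycleOf u) ⟩
      toℕ u % 7 + toℕ u / 7 * 7                   ≡⟨ m≡m%n+[m/n]*n (toℕ u) 7 ⟨
      toℕ u                                       ∎)
    where open ≡-Reasoning

  vertex-injective : ∀ {i j i′ j′} → vertex i j ≡ vertex i′ j′ → i ≡ i′ × j ≡ j′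
  vertex-injective {i} {j} {i′} {j′} eq =
    trans (sym (cycleOf-vertex i j)) (trans (cong cycleOf eq) (cycleOf-vertex i′ j′)) ,
    trans (sym (positionOf-vertex i j)) (trans (cong positionOf eq) (positionOf-vertex i′ j′))

  nextVertex : V → V
  nextVertex u = vertex (cycleOf u) (next (positionOf u))

  nextVertex-vertex : ∀ i j → nextVertex (vertex i j) ≡ vertex i (next j)
  nextVertex-vertex i j = cong₂ vertex (cycleOf-vertex i j) (cong next (positionOf-vertex i j))

  nextVertex-injective : ∀ {u v} → nextVertex u ≡ nextVertex v → u ≡ v
  nextVertex-injective {u} {v} eq with vertex-injective eq
  ... | same-cycle , same-next = begin
      u                                  ≡⟨ vertex-cycleOf-positionOf u ⟨
      vertex (cycleOf u) (positionOf u)  ≡⟨ cong₂ vertex same-cycle (next-injective _ _ same-next) ⟩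
      vertex (cycleOf v) (positionOf v)  ≡⟨ vertex-cycleOf-positionOf v ⟩
      v                                  ∎
    where open ≡-Reasoning

  sameCycle⇔ : ∀ {u v} → cycleOf u ≡ cycleOf v ⇔ toℕ u / 7 ≡ toℕ v / 7
  sameCycle⇔ {u} {v} = mk⇔
    (λ eq → trans (sym (toℕ-cycleOf u)) (trans (cong toℕ eq) (toℕ-cycleOf v)))
    (λ eq → toℕ-injective (trans (toℕ-cycleOf u) (trans eq (sym (toℕ-cycleOf v)))))

  follows⇔ : ∀ {u v} → positionOf v ≡ next (positionOf u) ⇔ toℕ v % 7 ≡ suc (toℕ u % 7) % 7
  follows⇔ {u} {v} = mk⇔
    (λ eq → trans (sym (toℕ-positionOf v)) (trans (cong toℕ eq) toℕ-next-positionOf))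
    (λ eq → toℕ-injective (trans (toℕ-positionOf v) (trans eq (sym toℕ-next-positionOf))))
    where
    toℕ-next-positionOf : toℕ (next (positionOf u)) ≡ suc (toℕ u % 7) % 7
    toℕ-next-positionOf = trans (toℕ-next (positionOf u)) (cong (λ x → suc x % 7) (toℕ-positionOf u))

  ≡nextVertex⇔ : ∀ {u v} → v ≡ nextVertex u ⇔ (cycleOf u ≡ cycleOf v × positionOf v ≡ next (positionOf u))
  ≡nextVertex⇔ {u} {v} = mk⇔
    (λ { refl → sym (cycleOf-vertex _ _) , positionOf-vertex _ _ })
    (λ (same-cycle , follows) → trans (sym (vertex-cycleOf-positionOf v)) (cong₂ vertex (sym same-cycle) follows))

  adj? : ∀ u v → Dec (Adj (kC7 k) u v)
  adj? u v = (toℕ u / 7 ℕ.≟ toℕ v / 7)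
             ×-dec ((toℕ u % 7 ℕ.≟ suc (toℕ v % 7) % 7) ⊎-dec (toℕ v % 7 ℕ.≟ suc (toℕ u % 7) % 7))

  adj-sym : ∀ u v → Adj (kC7 k) u v → Adj (kC7 k) v u
  adj-sym _ _ (same-cycle , follows) = sym same-cycle , swap follows

  adj-nextVertex : ∀ u → Adj (kC7 k) u (nextVertex u)
  adj-nextVertex u = let (same-cycle , follows) = to ≡nextVertex⇔ refl
                     in to sameCycle⇔ same-cycle , inj₂ (to follows⇔ follows)

  adj⇒nextVertex : ∀ {u v} → Adj (kC7 k) u v → u ≡ nextVertex v ⊎ v ≡ nextVertex u
  adj⇒nextVertex (c , inj₁ p) = inj₁ (from ≡nextVertex⇔ (sym (from sameCycle⇔ c) , from follows⇔ p))
  adj⇒nextVertex (c , inj₂ p) = inj₂ (from ≡nextVertex⇔ (from sameCycle⇔ c , from follows⇔ p))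

  -- Cuts of k C₇, cycle by cycle

  open CutSets (kC7 k) adj? public

  restrict : Subset (7 * k) → Fin k → Subset 7
  restrict A i = tabulate λ j → lookup A (vertex i j)

  cutOnCycle : Subset (7 * k) → Fin k → Subset 7
  cutOnCycle A i = boundary (restrict A i)

  lookup-cutOnCycle : ∀ A i j →
    lookup (cutOnCycle A i) j ≡ (lookup A (vertex i j) xor lookup A (vertex i (next j)))
  lookup-cutOnCycle A i j = trans (Vec.lookup∘tabulate (λ j → lookup s j xor lookup s (next j)) j)
    (cong₂ _xor_ (Vec.lookup∘tabulate onCycle j) (Vec.lookup∘tabulate onCycle (next j)))
    where
    onCycle : Fin 7 → Bool
    onCycle j = lookup A (vertex i j)
    s : Subset 7
    s = restrict A i

  cutSet-∋-vertex⇔ : ∀ {A i j} → cutSet A ∋ₑ vertex i j , vertex i (next j) ⇔ j ∈ₛ cutOnCycle A i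
  cutSet-∋-vertex⇔ {A} {i} {j} = mk⇔
    (λ e → from ∈ₛ⇔lookup (trans (lookup-cutOnCycle A i j)
                                  (to (separates⇔xor A _ _) (proj₂ (to cutSet-∋⇔ e)))))
    (λ j∈ → from cutSet-∋⇔ (adj , from (separates⇔xor A _ _)
                                        (trans (sym (lookup-cutOnCycle A i j)) (to ∈ₛ⇔lookup j∈))))
    where
    adj : Adj (kC7 k) (vertex i j) (vertex i (next j))
    adj = subst (Adj (kC7 k) (vertex i j)) (nextVertex-vertex i j) (adj-nextVertex (vertex i j))

  cutSet-∋-nextVertex⇔ : ∀ {A} u →
    cutSet A ∋ₑ u , nextVertex u ⇔ positionOf u ∈ₛ cutOnCycle A (cycleOf u)
  cutSet-∋-nextVertex⇔ {A} u =
    subst (λ x → cutSet A ∋ₑ x , nextVertex u ⇔ positionOf u ∈ₛ cutOnCycle A (cycleOf u))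
          (vertex-cycleOf-positionOf u) cutSet-∋-vertex⇔

  cutSet-∋⇒nextVertex : ∀ {A u v} → cutSet A ∋ₑ u , v → u ≡ nextVertex v ⊎ v ≡ nextVertex u
  cutSet-∋⇒nextVertex = adj⇒nextVertex ∘ proj₁ ∘ to cutSet-∋⇔

  cutSet-mono : ∀ {A B} → (∀ i → cutOnCycle A i ⊆ cutOnCycle B i) → cutSet A ⊆ₑ cutSet B
  cutSet-mono A⊆B u v uv with cutSet-∋⇒nextVertex uv
  ... | inj₂ refl = from (cutSet-∋-nextVertex⇔ u) (A⊆B _ (to (cutSet-∋-nextVertex⇔ u) uv))
  ... | inj₁ refl = cutSet-sym adj-sym (from (cutSet-∋-nextVertex⇔ v)
                                         (A⊆B _ (to (cutSet-∋-nextVertex⇔ v) (cutSet-sym adj-sym uv))))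

  cutOnCycle-mono : ∀ {A B} → cutSet A ⊆ₑ cutSet B → ∀ i → cutOnCycle A i ⊆ cutOnCycle B i
  cutOnCycle-mono A⊆B i j∈ = to cutSet-∋-vertex⇔ (A⊆B _ _ (from cutSet-∋-vertex⇔ j∈))

  cutSet-cong : ∀ {A B} → (∀ i → cutOnCycle A i ≡ cutOnCycle B i) → cutSet A ≡ cutSet B
  cutSet-cong A≡B = ⊆ₑ-antisym (cutSet-mono (⊆-reflexive ∘ A≡B)) (cutSet-mono (⊆-reflexive ∘ sym ∘ A≡B))

  cutOnCycle-cong : ∀ {A B} → cutSet A ≡ cutSet B → ∀ i → cutOnCycle A i ≡ cutOnCycle B i
  cutOnCycle-cong A≡B i =
    ⊆-antisym (cutOnCycle-mono (⊆ₑ-reflexive A≡B) i) (cutOnCycle-mono (⊆ₑ-reflexive (sym A≡B)) i)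

  isMatching⇒isCycleMatching : ∀ {A} → IsMatching (cutSet A) → ∀ i → IsCycleMatching (cutOnCycle A i)
  isMatching⇒isCycleMatching matching i j j∈ next-j∈ =
    next²≢id j (proj₂ (vertex-injective
      (matching (vertex i (next j)) (vertex i j) (vertex i (next (next j)))
                (cutSet-sym adj-sym (from cutSet-∋-vertex⇔ j∈)) (from cutSet-∋-vertex⇔ next-j∈))))

  isCycleMatching⇒¬consecutive : ∀ {A} → (∀ i → IsCycleMatching (cutOnCycle A i)) → ∀ x →
    cutSet A ∋ₑ x , nextVertex x → ¬ cutSet A ∋ₑ nextVertex x , nextVertex (nextVertex x)
  isCycleMatching⇒¬consecutive {A} cycleMatching x e e⁺ =
    cycleMatching (cycleOf x) (positionOf x) (to (cutSet-∋-nextVertex⇔ x) e)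
      (subst₂ (λ i j → j ∈ₛ cutOnCycle A i) (cycleOf-vertex _ _) (positionOf-vertex _ _)
              (to (cutSet-∋-nextVertex⇔ (nextVertex x)) e⁺))

  isCycleMatching⇒isMatching : ∀ {A} → (∀ i → IsCycleMatching (cutOnCycle A i)) → IsMatching (cutSet A)
  isCycleMatching⇒isMatching cycleMatching u v w uv uw
    with cutSet-∋⇒nextVertex uv | cutSet-∋⇒nextVertex uw
  ... | inj₂ refl  | inj₂ refl  = refl
  ... | inj₁ u≡v⁺ | inj₁ u≡w⁺ = nextVertex-injective (trans (sym u≡v⁺) u≡w⁺)
  ... | inj₁ refl  | inj₂ refl  =
    ⊥-elim (isCycleMatching⇒¬consecutive cycleMatching v (cutSet-sym adj-sym uv) uw)
  ... | inj₂ refl  | inj₁ refl  =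
    ⊥-elim (isCycleMatching⇒¬consecutive cycleMatching w (cutSet-sym adj-sym uw) uv)

  glue : (Fin k → Subset 7) → Subset (7 * k)
  glue f = tabulate λ u → lookup (f (cycleOf u)) (positionOf u)

  lookup-glue : ∀ f i j → lookup (glue f) (vertex i j) ≡ lookup (f i) j
  lookup-glue f i j = trans (Vec.lookup∘tabulate (λ u → lookup (f (cycleOf u)) (positionOf u)) (vertex i j))
                            (cong₂ (λ i j → lookup (f i) j) (cycleOf-vertex i j) (positionOf-vertex i j))

  cutOnCycle-glue : ∀ f i → cutOnCycle (glue f) i ≡ boundary (f i)
  cutOnCycle-glue f i = cong boundary (trans (Vec.tabulate-cong (lookup-glue f i)) (Vec.tabulate∘lookup (f i)))

  ∁-glue : ∀ f → ∁ (glue f) ≡ glue (∁ ∘ f)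
  ∁-glue f = trans (sym (Vec.tabulate-∘ not (λ u → lookup (f (cycleOf u)) (positionOf u))))
                   (Vec.tabulate-cong λ u → sym (Vec.lookup-map (positionOf u) not (f (cycleOf u))))

  glue-nonempty : ∀ f i → Nonempty (f i) → Nonempty (glue f)
  glue-nonempty f i (j , j∈) = vertex i j , from ∈ₛ⇔lookup (trans (lookup-glue f i j) (to ∈ₛ⇔lookup j∈))

  glue-isMatchingCut : ∀ f i → Nonempty (f i) → Nonempty (∁ (f i)) →
                       (∀ i → IsCycleMatching (boundary (f i))) → IsMatchingCut (kC7 k) (cutSet (glue f))
  glue-isMatchingCut f i inside outside cycleMatching =
    isCycleMatching⇒isMatching (λ i → subst IsCycleMatching (sym (cutOnCycle-glue f i)) (cycleMatching i)) ,
    glue f , glue-nonempty f i inside ,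
    subst Nonempty (sym (∁-glue f)) (glue-nonempty (∁ ∘ f) i outside) ,
    cutSet-isCut (glue f)

  isMatchingCut⇒≡cutSet : ∀ {M} → IsMatchingCut (kC7 k) M →
                          ∃[ A ] M ≡ cutSet A × (∀ i → IsCycleMatching (cutOnCycle A i))
  isMatchingCut⇒≡cutSet {M} (matching , A , _ , _ , cut) =
    A , M≡ , isMatching⇒isCycleMatching (subst IsMatching M≡ matching)
    where
    M≡ : M ≡ cutSet A
    M≡ = isCut⇒≡cutSet cut

  -- Maximal matching cuts of k C₇

  arcCut : Vec (Fin 14) k → EdgeSet (7 * k)
  arcCut c = cutSet (glue (arc ∘ lookup c))

  cutOnCycle-arcCut : ∀ c i → cutOnCycle (glue (arc ∘ lookup c)) i ≡ boundary (arc (lookup c i))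
  cutOnCycle-arcCut c = cutOnCycle-glue (arc ∘ lookup c)

  arcCut-isMaximal : Fin k → ∀ c → IsMaximalMatchingCut (kC7 k) (arcCut c)
  arcCut-isMaximal i c =
    glue-isMatchingCut (arc ∘ lookup c) i (arc-nonempty (lookup c i)) (arc-∁-nonempty (lookup c i))
                       (boundary-arc-isCycleMatching ∘ lookup c) ,
    maximal
    where
    maximal : ∀ M → IsMatchingCut (kC7 k) M → arcCut c ⊆ₑ M → M ≡ arcCut c
    maximal M mc c⊆M with isMatchingCut⇒≡cutSet {M} mc
    ... | A , refl , cycleMatching = cutSet-cong λ i →
      trans (boundary-arc-maximal (restrict A i) (lookup c i) (cycleMatching i)
               (subst (_⊆ cutOnCycle A i) (cutOnCycle-arcCut c i) (cutOnCycle-mono c⊆M i)))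
            (sym (cutOnCycle-arcCut c i))

  arcCut-injective : ∀ c c′ → arcCut c ≡ arcCut c′ → c ≡ c′
  arcCut-injective c c′ eq = Pointwise-≡⇒≡ (ext λ i →
    boundary-arc-injective (lookup c i) (lookup c′ i) (begin
      boundary (arc (lookup c i))            ≡⟨ cutOnCycle-arcCut c i ⟨
      cutOnCycle (glue (arc ∘ lookup c)) i   ≡⟨ cutOnCycle-cong eq i ⟩
      cutOnCycle (glue (arc ∘ lookup c′)) i  ≡⟨ cutOnCycle-arcCut c′ i ⟩
      boundary (arc (lookup c′ i))           ∎))
    where open ≡-Reasoning

  -- Filling an empty cycle with an arc gives a larger matching cut.
  isMaximal⇒cutOnCycle≢⊥ : ∀ {A} → IsMaximalMatchingCut (kC7 k) (cutSet A) → ∀ i → cutOnCycle A i ≢ ⊥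
  isMaximal⇒cutOnCycle≢⊥ {A} ((matching , _) , maximal) i empty = ∉⊥ (subst (zero ∈ₛ_) empty zero∈)
    where
    filled : Fin k → Subset 7
    filled = updateAt (restrict A) i (const (arc zero))

    filled-i : filled i ≡ arc zero
    filled-i = updateAt-updates i (restrict A)

    filled-≢ : ∀ {i′} → i′ ≢ i → filled i′ ≡ restrict A i′
    filled-≢ {i′} i′≢i = updateAt-minimal i′ i (restrict A) i′≢i

    cycleMatching : ∀ i′ → IsCycleMatching (boundary (filled i′))
    cycleMatching i′ with i′ ≟ᶠ i
    ... | yes refl = subst (IsCycleMatching ∘ boundary) (sym filled-i) (boundary-arc-isCycleMatching zero)
    ... | no i′≢i  = subst (IsCycleMatching ∘ boundary) (sym (filled-≢ i′≢i))
                           (isMatching⇒isCycleMatching matching i′)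

    grows : ∀ i′ → cutOnCycle A i′ ⊆ cutOnCycle (glue filled) i′
    grows i′ with i′ ≟ᶠ i
    ... | yes refl = subst (_⊆ cutOnCycle (glue filled) i) (sym empty)
                           (⊆-min (cutOnCycle (glue filled) i))
    ... | no i′≢i  = ⊆-reflexive (sym (trans (cutOnCycle-glue filled i′) (cong boundary (filled-≢ i′≢i))))

    filled-isMatchingCut : IsMatchingCut (kC7 k) (cutSet (glue filled))
    filled-isMatchingCut = glue-isMatchingCut filled i
      (subst Nonempty (sym filled-i) (arc-nonempty zero))
      (subst (Nonempty ∘ ∁) (sym filled-i) (arc-∁-nonempty zero))
      cycleMatching

    filled≡A : cutSet (glue filled) ≡ cutSet A
    filled≡A = maximal (cutSet (glue filled)) filled-isMatchingCut (cutSet-mono grows)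

    zero∈ : zero ∈ₛ cutOnCycle A i
    zero∈ = subst (zero ∈ₛ_) (begin
        boundary (arc zero)              ≡⟨ cong boundary filled-i ⟨
        boundary (filled i)              ≡⟨ cutOnCycle-glue filled i ⟨
        cutOnCycle (glue filled) i       ≡⟨ cutOnCycle-cong filled≡A i ⟩
        cutOnCycle A i                   ∎)
      zero∈boundary-arc-zero
      where open ≡-Reasoning

  isMaximal⇒cutOnCycle≡arc : ∀ {A} → IsMaximalMatchingCut (kC7 k) (cutSet A) →
                              ∀ i → ∃[ t ] cutOnCycle A i ≡ boundary (arc t)
  isMaximal⇒cutOnCycle≡arc {A} maximal@((matching , _) , _) i
    with isCycleMatching-boundary⇒arc⊎⊥ (restrict A i) (isMatching⇒isCycleMatching matching i)
  ... | inj₁ found = found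
  ... | inj₂ empty = ⊥-elim (isMaximal⇒cutOnCycle≢⊥ {A} maximal i empty)

  isMaximal⇒arcCut : ∀ {M} → IsMaximalMatchingCut (kC7 k) M → ∃[ c ] M ≡ arcCut c
  isMaximal⇒arcCut {M} maximal@(mc , _) with isMatchingCut⇒≡cutSet {M} mc
  ... | A , refl , _ = c , cutSet-cong λ i → begin
      cutOnCycle A i                      ≡⟨ proj₂ (arcOf i) ⟩
      boundary (arc (proj₁ (arcOf i)))    ≡⟨ cong (boundary ∘ arc) (Vec.lookup∘tabulate (proj₁ ∘ arcOf) i) ⟨
      boundary (arc (lookup c i))         ≡⟨ cutOnCycle-arcCut c i ⟨
      cutOnCycle (glue (arc ∘ lookup c)) i ∎
    where
    open ≡-Reasoning
    arcOf : ∀ i → ∃[ t ] cutOnCycle A i ≡ boundary (arc t)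
    arcOf = isMaximal⇒cutOnCycle≡arc {A} maximal
    c : Vec (Fin 14) k
    c = tabulate (proj₁ ∘ arcOf)

-- Counting

vectors : ∀ {A : Set} → List A → ∀ k → List (Vec A k)
vectors xs zero    = [] ∷ []
vectors xs (suc k) = cartesianProductWith _∷_ xs (vectors xs k)

length-cartesianProductWith : ∀ {A B C : Set} (f : A → B → C) xs ys →
                              length (cartesianProductWith f xs ys) ≡ length xs * length ys
length-cartesianProductWith f []       ys = refl
length-cartesianProductWith f (x ∷ xs) ys = trans (List.length-++ (map (f x) ys))
  (cong₂ _+_ (List.length-map (f x) ys) (length-cartesianProductWith f xs ys))

length-vectors : ∀ {A : Set} (xs : List A) k → length (vectors xs k) ≡ length xs ^ k
length-vectors xs zero    = refl
length-vectors xs (suc k) = trans (length-cartesianProductWith _∷_ xs (vectors xs k))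
                                  (cong (length xs *_) (length-vectors xs k))

vectors-unique : ∀ {A : Set} {xs : List A} → Unique xs → ∀ k → Unique (vectors xs k)
vectors-unique xs! zero    = All.[] AllPairs.∷ AllPairs.[]
vectors-unique xs! (suc k) = Unique.cartesianProductWith⁺ _∷_ Vec.∷-injective xs! (vectors-unique xs! k)

∈-vectors : ∀ {A : Set} {xs : List A} → (∀ x → x ∈ xs) → ∀ {k} (v : Vec A k) → v ∈ vectors xs k
∈-vectors x∈xs []       = here refl
∈-vectors x∈xs (x ∷ v) =
  Any.cartesianProductWith⁺ _∷_ {P = x ≡_} {Q = v ≡_} (cong₂ _∷_) (x∈xs x) (∈-vectors x∈xs v)

^-distribʳ-* : ∀ a b c → (a * b) ^ c ≡ a ^ c * b ^ c
^-distribʳ-* a b zero    = refl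
^-distribʳ-* a b (suc c) = trans (cong (a * b *_) (^-distribʳ-* a b c)) (interchange a b (a ^ c) (b ^ c))

14579^[7k]≤14^k*10000^[7k] : ∀ k → 14579 ^ (7 * k) ≤ 14 ^ k * 10000 ^ (7 * k)
14579^[7k]≤14^k*10000^[7k] k = begin
    14579 ^ (7 * k)           ≡⟨ ℕ.^-*-assoc 14579 7 k ⟨
    (14579 ^ 7) ^ k           ≤⟨ ℕ.^-monoˡ-≤ k (ℕ.≤ᵇ⇒≤ (14579 ^ 7) (14 * 10000 ^ 7) tt) ⟩
    (14 * 10000 ^ 7) ^ k      ≡⟨ ^-distribʳ-* 14 (10000 ^ 7) k ⟩
    14 ^ k * (10000 ^ 7) ^ k  ≡⟨ cong (14 ^ k *_) (ℕ.^-*-assoc 10000 7 k) ⟩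
    14 ^ k * 10000 ^ (7 * k)  ∎
  where open ℕ.≤-Reasoning

proposition11 : (k : ℕ) → .{{_ : NonZero k}} →
    (∃[ L ] (Unique L
             × (∀ M → (M ∈ L) ⇔ IsMaximalMatchingCut (kC7 k) M)
             × length L ≡ 14 ^ k))
    × (14579 ^ (7 * k) ≤ 14 ^ k * 10000 ^ (7 * k))
proposition11 k@(suc _) = (L , L-unique , ∈L⇔isMaximal , length-L) , 14579^[7k]≤14^k*10000^[7k] k
  where
  open Cycles k
  L : List (EdgeSet (7 * k))
  L = map arcCut (vectors (allFin 14) k)

  L-unique : Unique L
  L-unique = Unique.map⁺ (arcCut-injective _ _) (vectors-unique (Unique.allFin⁺ 14) k)

  ∈L⇔isMaximal : ∀ M → M ∈ L ⇔ IsMaximalMatchingCut (kC7 k) M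
  ∈L⇔isMaximal M = mk⇔
    (λ M∈L → let (c , _ , M≡) = ∈-map⁻ arcCut M∈L in
             subst (IsMaximalMatchingCut (kC7 k)) (sym M≡) (arcCut-isMaximal zero c))
    (λ maximal → let (c , M≡) = isMaximal⇒arcCut maximal in
                 subst (_∈ L) (sym M≡) (∈-map⁺ arcCut (∈-vectors ∈-allFin c)))

  length-L : length L ≡ 14 ^ k
  length-L = trans (List.length-map arcCut (vectors (allFin 14) k)) (length-vectors (allFin 14) k)
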